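{- Let $(F_n)$ be the Fibonacci sequence and $\phi=(1+\sqrt5)/2$. For every complex number $w$ different from $0$, $1/2$, $\phi$ and $-1/\phi$, and every positive integer $n$, \[ F_{n}=\sum_{j=1}^{n}\sum_{r=0}^{\lfloor (j-1)/2\rfloor}\binom{n}{j}\binom{j-1-r}{r}w^{n-j}(1-2w)^{j-1-2r}(1+w-w^{2})^{r}. \]
   Context: The Fibonacci sequence is defined by $F_0=0$, $F_1=1$, $F_{i+1}=F_i+F_{i-1}$ for $i\ge1$. -}

module Defs where

open import Data.Nat using (ℕ; zero; suc; _+_; _∸_)
open import Algebra.Bundles using (CommutativeRing)

fib : ℕ → ℕ
fib zero = 0
fib (suc zero) = 1
fib (suc (suc n)) = fib (suc n) + fib n

module RingSum {c ℓ} (R : CommutativeRing c ℓ) where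
  open CommutativeRing R using (Carrier; 0#) renaming (_+_ to _⊕_)

  sumFrom : ℕ → ℕ → (ℕ → Carrier) → Carrier
  sumFrom a zero f = 0#
  sumFrom a (suc k) f = f a ⊕ sumFrom (suc a) k f

  -- Σ_{i=a}^{b} f i  (empty, i.e. 0#, when b < a)
  Σ[_to_] : ℕ → ℕ → (ℕ → Carrier) → Carrier
  Σ[ a to b ] f = sumFrom a (suc b ∸ a) f

module Submission where

-- The Fibonacci numbers as a binomial transform of Fibonacci polynomials.
--
-- Put a = 1 - 2w and b = 1 + w - w².  The inner sum of the identity,
--   U m = Σ_{r ≤ m/2} C(m-r, r) a^(m-2r) b^r ,
-- is the Fibonacci polynomial: a diagonal sum in Pascal's triangle, so by
-- Pascal's rule U (m+2) = a U (m+1) + b U m, with U 0 = 1 and U 1 = a.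
-- Hence V = 0, U 0, U 1, … satisfies V (k+2) = a V (k+1) + b V k.
-- The binomial transform T s n = Σ_j C(n,j) w^(n-j) s j obeys
-- T s (n+1) = w T s n + T (s ∘ suc) n; applying this twice and using the
-- recurrence of s shows that T turns the (a, b)-recurrence into the
-- Fibonacci recurrence exactly when a + 2w = 1 and b + w² = 1 + w.  So T V
-- is the Fibonacci sequence of the ring (it starts 0, 1), and unfolding T V n
-- gives the identity.  It thus holds for every w in every commutative ring.

open import Defs
open import Data.Nat using (ℕ; suc; _∸_; _/_; NonZero) renaming (_*_ to _*ℕ_)
open import Data.Nat.Combinatorics using (_C_)
open import Algebra.Bundles using (CommutativeRing; Semiring)
open import Algebra.Definitions.RawSemiring using (_×_; _^_)
open import Relation.Nullary using (¬_)

open import Data.Nat using (zero; _≤_; _<_; s≤s; _≤?_; _<?_) renaming (_+_ to _+ℕ_)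
import Data.Nat.Properties as ℕₚ
open import Data.Nat.DivMod using (m*n/n≡m; /-monoˡ-≤; m/n≤m)
open import Data.Nat.Combinatorics using (k>n⇒nCk≡0; nCk+nC[k+1]≡[n+1]C[k+1])
open import Relation.Binary.PropositionalEquality as ≡ using (_≡_)
open import Relation.Nullary using (yes; no; contradiction)
import Algebra.Properties.Monoid.Mult as Mult

∸-suc : ∀ {n e} → e < n → n ∸ e ≡ suc (n ∸ suc e)
∸-suc {suc n} {zero}  _         = ≡.refl
∸-suc {suc n} {suc e} (s≤s e<n) = ∸-suc e<n

diagonal-pascal : ∀ m r → (suc m ∸ r) C suc r ≡ (m ∸ r) C r +ℕ (m ∸ r) C suc r
diagonal-pascal m r with r ≤? m
... | yes r≤m = ≡.trans (≡.cong (_C suc r) (ℕₚ.+-∸-assoc 1 r≤m))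
                        (≡.sym (nCk+nC[k+1]≡[n+1]C[k+1] (m ∸ r) r))
... | no r≰m
  rewrite ℕₚ.m≤n⇒m∸n≡0 (ℕₚ.≰⇒> r≰m) | ℕₚ.m≤n⇒m∸n≡0 (ℕₚ.<⇒≤ (ℕₚ.≰⇒> r≰m))
  = row-zero r (ℕₚ.≰⇒> r≰m)
  where
  row-zero : ∀ r → m < r → 0 C suc r ≡ 0 C r +ℕ 0 C suc r
  row-zero (suc r) _ = ≡.refl

diagonal-vanish : ∀ m r → m / 2 < r → (m ∸ r) C r ≡ 0
diagonal-vanish m r m/2<r with r ≤? m ∸ r
... | no  r≰m∸r = k>n⇒nCk≡0 (ℕₚ.≰⇒> r≰m∸r)
... | yes r≤m∸r = contradiction r≤m/2 (ℕₚ.<⇒≱ m/2<r)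
  where
  r*2≤m : r *ℕ 2 ≤ m
  r*2≤m = ≡.subst (_≤ m) (≡.trans (≡.cong (r +ℕ_) (≡.sym (ℕₚ.+-identityʳ r))) (ℕₚ.*-comm 2 r))
            (ℕₚ.m≤o∸n⇒m+n≤o r (ℕₚ.≤-trans r≤m∸r (ℕₚ.m∸n≤m m r)) r≤m∸r)
  r≤m/2 : r ≤ m / 2
  r≤m/2 = ≡.subst (_≤ m / 2) (m*n/n≡m r 2) (/-monoˡ-≤ 2 r*2≤m)

diagonal-vanish-suc : ∀ m r → m ≤ 2 *ℕ r → (m ∸ r) C suc r ≡ 0
diagonal-vanish-suc m r m≤2r =
  k>n⇒nCk≡0 (s≤s (≡.subst (m ∸ r ≤_) (ℕₚ.+-identityʳ r) (ℕₚ.m≤n+o⇒m∸n≤o m r m≤2r)))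

module FibonacciIdentity {c ℓ} (R : CommutativeRing c ℓ) where
  open CommutativeRing R
  open RingSum R
  open import Relation.Binary.Reasoning.Setoid setoid
  open import Algebra.Solver.Ring.NaturalCoefficients.Default commutativeSemiring
    using (solve; _:=_; _:+_; _:*_)
  open Mult +-monoid using (×-homo-+)
  open import Algebra.Properties.CommutativeSemigroup +-commutativeSemigroup
    using () renaming (interchange to +-interchange)
  open import Algebra.Properties.CommutativeSemigroup *-commutativeSemigroup
    using (x∙yz≈y∙xz)

  _·_ : ℕ → Carrier → Carrier
  _·_ = _×_ (Semiring.rawSemiring semiring)

  _^^_ : Carrier → ℕ → Carrier
  _^^_ = _^_ (Semiring.rawSemiring semiring)

  -- Used to discharge a + 2w = 1 and b + w² = 1 + w for a = 1 - 2w, b = 1 + w - w².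
  minus-plus : ∀ x y → x - y + y ≈ x
  minus-plus x y = begin
    x - y + y      ≈⟨ +-assoc x (- y) y ⟩
    x + (- y + y)  ≈⟨ +-congˡ (-‿inverseˡ y) ⟩
    x + 0#         ≈⟨ +-identityʳ x ⟩
    x              ∎

  power-step : ∀ k x n e → (n ≤ e → k ≡ 0) →
               (k · 1#) * (x ^^ (n ∸ e)) ≈ x * ((k · 1#) * (x ^^ (n ∸ suc e)))
  power-step k x n e vanishes with e <? n
  ... | yes e<n = begin
    (k · 1#) * (x ^^ (n ∸ e))                ≡⟨ ≡.cong (λ d → (k · 1#) * (x ^^ d)) (∸-suc e<n) ⟩
    (k · 1#) * (x * (x ^^ (n ∸ suc e)))      ≈⟨ x∙yz≈y∙xz (k · 1#) x _ ⟩
    x * ((k · 1#) * (x ^^ (n ∸ suc e)))      ∎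
  ... | no e≮n with vanishes (ℕₚ.≮⇒≥ e≮n)
  ...   | ≡.refl = trans (zeroˡ _) (sym (trans (*-congˡ (zeroˡ _)) (zeroʳ x)))

  sum-cong : ∀ a k {f g : ℕ → Carrier} → (∀ i → a ≤ i → f i ≈ g i) →
             sumFrom a k f ≈ sumFrom a k g
  sum-cong a zero    f≈g = refl
  sum-cong a (suc k) f≈g = +-cong (f≈g a ℕₚ.≤-refl) (sum-cong (suc a) k (λ i a<i → f≈g i (ℕₚ.<⇒≤ a<i)))

  sum-shift : ∀ a k f → sumFrom (suc a) k f ≈ sumFrom a k (λ i → f (suc i))
  sum-shift a zero    f = refl
  sum-shift a (suc k) f = +-congˡ (sum-shift (suc a) k f)

  sum-+ : ∀ a k f g → sumFrom a k (λ i → f i + g i) ≈ sumFrom a k f + sumFrom a k g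
  sum-+ a zero    f g = sym (+-identityʳ 0#)
  sum-+ a (suc k) f g = trans (+-congˡ (sum-+ (suc a) k f g)) (+-interchange (f a) (g a) _ _)

  sum-* : ∀ a k x f → sumFrom a k (λ i → x * f i) ≈ x * sumFrom a k f
  sum-* a zero    x f = sym (zeroʳ x)
  sum-* a (suc k) x f = trans (+-congˡ (sum-* (suc a) k x f)) (sym (distribˡ x (f a) _))

  sum-drop-last : ∀ a k f → f (a +ℕ k) ≈ 0# → sumFrom a (suc k) f ≈ sumFrom a k f
  sum-drop-last a zero    f last≈0 =
    trans (+-congʳ (trans (reflexive (≡.cong f (≡.sym (ℕₚ.+-identityʳ a)))) last≈0)) (+-identityʳ 0#)
  sum-drop-last a (suc k) f last≈0 =
    +-congˡ (sum-drop-last (suc a) k f (trans (reflexive (≡.cong f (≡.sym (ℕₚ.+-suc a k)))) last≈0))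

  sum-drop-tail : ∀ a k e f → (∀ i → a +ℕ k ≤ i → f i ≈ 0#) → sumFrom a (k +ℕ e) f ≈ sumFrom a k f
  sum-drop-tail a k zero    f tail≈0 = reflexive (≡.cong (λ l → sumFrom a l f) (ℕₚ.+-identityʳ k))
  sum-drop-tail a k (suc e) f tail≈0 = begin
    sumFrom a (k +ℕ suc e) f   ≡⟨ ≡.cong (λ l → sumFrom a l f) (ℕₚ.+-suc k e) ⟩
    sumFrom a (suc (k +ℕ e)) f ≈⟨ sum-drop-last a (k +ℕ e) f (tail≈0 _ (ℕₚ.+-monoʳ-≤ a (ℕₚ.m≤m+n k e))) ⟩
    sumFrom a (k +ℕ e) f       ≈⟨ sum-drop-tail a k e f tail≈0 ⟩
    sumFrom a k f              ∎

  FibonacciRecurrent : (ℕ → Carrier) → Set ℓ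
  FibonacciRecurrent t = ∀ k → t (suc (suc k)) ≈ t (suc k) + t k

  Recurrent : Carrier → Carrier → (ℕ → Carrier) → Set ℓ
  Recurrent a b s = ∀ k → s (suc (suc k)) ≈ a * s (suc k) + b * s k

  fib-unique : ∀ t → FibonacciRecurrent t → t 0 ≈ 0# → t 1 ≈ 1# → ∀ n → (fib n · 1#) ≈ t n
  fib-unique t rec t0 t1 zero          = sym t0
  fib-unique t rec t0 t1 (suc zero)    = trans (+-identityʳ 1#) (sym t1)
  fib-unique t rec t0 t1 (suc (suc n)) = begin
    fib (suc (suc n)) · 1#            ≈⟨ ×-homo-+ 1# (fib (suc n)) (fib n) ⟩
    (fib (suc n) · 1#) + (fib n · 1#) ≈⟨ +-cong (fib-unique t rec t0 t1 (suc n)) (fib-unique t rec t0 t1 n) ⟩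
    t (suc n) + t n                   ≈⟨ rec n ⟨
    t (suc (suc n))                   ∎

  -- Fibonacci polynomials U m = Σ_{r=0}^{m} C(m-r, r) a^(m-2r) b^r
  -- (the terms with 2r > m vanish).
  module FibonacciPolynomials (a b : Carrier) where

    diagonalTerm : ℕ → ℕ → Carrier
    diagonalTerm m r = ((((m ∸ r) C r) · 1#) * (a ^^ (m ∸ (2 *ℕ r)))) * (b ^^ r)

    fibonacciPolynomial : ℕ → Carrier
    fibonacciPolynomial m = Σ[ 0 to m ] (diagonalTerm m)

    diagonalTerm-vanish : ∀ m r → (m ∸ r) C r ≡ 0 → diagonalTerm m r ≈ 0#
    diagonalTerm-vanish m r C≡0 = begin
      diagonalTerm m r
        ≡⟨ ≡.cong (λ k → ((k · 1#) * (a ^^ (m ∸ (2 *ℕ r)))) * (b ^^ r)) C≡0 ⟩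
      (0# * (a ^^ (m ∸ (2 *ℕ r)))) * (b ^^ r) ≈⟨ *-congʳ (zeroˡ _) ⟩
      0# * (b ^^ r)                           ≈⟨ zeroˡ _ ⟩
      0#                                      ∎

    diagonalTerm-step : ∀ m r →
      diagonalTerm (suc (suc m)) (suc r) ≈ b * diagonalTerm m r + a * diagonalTerm (suc m) (suc r)
    diagonalTerm-step m r = begin
      diagonalTerm (suc (suc m)) (suc r)
        ≡⟨ ≡.cong₂ (λ k e → ((k · 1#) * (a ^^ e)) * (b ^^ suc r))
                   (diagonal-pascal m r) (≡.cong (suc (suc m) ∸_) (ℕₚ.*-suc 2 r)) ⟩
      ((((m ∸ r) C r +ℕ (m ∸ r) C suc r) · 1#) * A) * (b * B)
        ≈⟨ *-congʳ (*-congʳ (×-homo-+ 1# ((m ∸ r) C r) ((m ∸ r) C suc r))) ⟩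
      ((X + Y) * A) * (b * B)
        ≈⟨ split b X Y A B ⟩
      b * diagonalTerm m r + (Y * A) * (b * B)
        ≈⟨ +-congˡ (*-congʳ (power-step ((m ∸ r) C suc r) a m (2 *ℕ r)
                                          (diagonal-vanish-suc m r))) ⟩
      b * diagonalTerm m r + (a * (Y * A′)) * (b * B)
        ≈⟨ +-congˡ (*-assoc a _ _) ⟩
      b * diagonalTerm m r + a * ((Y * A′) * (b * B))
        ≡⟨ ≡.cong (λ e → b * diagonalTerm m r + a * ((Y * (a ^^ e)) * (b * B)))
                  (≡.sym (≡.cong (suc m ∸_) (ℕₚ.*-suc 2 r))) ⟩
      b * diagonalTerm m r + a * diagonalTerm (suc m) (suc r) ∎
      where
      X = ((m ∸ r) C r) · 1#
      Y = ((m ∸ r) C suc r) · 1#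
      A = a ^^ (m ∸ (2 *ℕ r))
      A′ = a ^^ (m ∸ suc (2 *ℕ r))
      B = b ^^ r
      split : ∀ b X Y A B → ((X + Y) * A) * (b * B) ≈ b * ((X * A) * B) + (Y * A) * (b * B)
      split = solve 5 (λ b X Y A B →
        (((X :+ Y) :* A) :* (b :* B)) := ((b :* ((X :* A) :* B)) :+ ((Y :* A) :* (b :* B)))) refl

    diagonalTerm-beyond : ∀ m r → m < r → diagonalTerm m r ≈ 0#
    diagonalTerm-beyond m r m<r =
      diagonalTerm-vanish m r (k>n⇒nCk≡0 (ℕₚ.≤-<-trans (ℕₚ.m∸n≤m m r) m<r))

    diagonalTerm-head : ∀ m → diagonalTerm (suc m) 0 ≈ a * diagonalTerm m 0
    diagonalTerm-head m = rearrange a _ _ _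
      where
      rearrange : ∀ a k A B → (k * (a * A)) * B ≈ a * ((k * A) * B)
      rearrange = solve 4 (λ a k A B → ((k :* (a :* A)) :* B) := (a :* ((k :* A) :* B))) refl

    fibonacciPolynomial-truncate : ∀ m → fibonacciPolynomial m ≈ Σ[ 0 to m / 2 ] (diagonalTerm m)
    fibonacciPolynomial-truncate m = begin
      sumFrom 0 (suc m) (diagonalTerm m)
        ≡⟨ ≡.cong (λ k → sumFrom 0 (suc k) (diagonalTerm m)) (ℕₚ.m+[n∸m]≡n (m/n≤m m 2)) ⟨
      sumFrom 0 (suc (m / 2) +ℕ (m ∸ m / 2)) (diagonalTerm m)
        ≈⟨ sum-drop-tail 0 (suc (m / 2)) (m ∸ m / 2) (diagonalTerm m)
             (λ r m/2<r → diagonalTerm-vanish m r (diagonal-vanish m r m/2<r)) ⟩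
      sumFrom 0 (suc (m / 2)) (diagonalTerm m) ∎

    -- The recurrence U (m+2) = a U (m+1) + b U m: split off the r = 0 term and
    -- apply diagonalTerm-step to the others; both resulting sums lose a zero top term.
    fibonacciPolynomial-step : ∀ m →
      fibonacciPolynomial (suc (suc m)) ≈ a * fibonacciPolynomial (suc m) + b * fibonacciPolynomial m
    fibonacciPolynomial-step m = begin
      diagonalTerm (2 +ℕ m) 0 + sumFrom 1 (2 +ℕ m) (diagonalTerm (2 +ℕ m))
        ≈⟨ +-cong (diagonalTerm-head (suc m)) (sum-shift 0 (2 +ℕ m) (diagonalTerm (2 +ℕ m))) ⟩
      a * diagonalTerm (suc m) 0 + sumFrom 0 (2 +ℕ m) (λ r → diagonalTerm (2 +ℕ m) (suc r))
        ≈⟨ +-congˡ (sum-cong 0 (2 +ℕ m) (λ r _ → diagonalTerm-step m r)) ⟩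
      a * diagonalTerm (suc m) 0 + sumFrom 0 (2 +ℕ m) (λ r → b * diagonalTerm m r + a * diagonalTerm (suc m) (suc r))
        ≈⟨ +-congˡ (sum-+ 0 (2 +ℕ m) _ _) ⟩
      a * diagonalTerm (suc m) 0 + (sumFrom 0 (2 +ℕ m) (λ r → b * diagonalTerm m r)
                                     + sumFrom 0 (2 +ℕ m) (λ r → a * diagonalTerm (suc m) (suc r)))
        ≈⟨ +-congˡ (+-cong (sum-* 0 (2 +ℕ m) b _) (sum-* 0 (2 +ℕ m) a _)) ⟩
      a * diagonalTerm (suc m) 0 + (b * sumFrom 0 (2 +ℕ m) (diagonalTerm m)
                                     + a * sumFrom 0 (2 +ℕ m) (λ r → diagonalTerm (suc m) (suc r)))
        ≈⟨ +-congˡ (+-cong (*-congˡ lower) (*-congˡ upper)) ⟩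
      a * diagonalTerm (suc m) 0 + (b * fibonacciPolynomial m + a * sumFrom 1 (suc m) (diagonalTerm (suc m)))
        ≈⟨ regroup a b _ _ _ ⟩
      a * fibonacciPolynomial (suc m) + b * fibonacciPolynomial m ∎
      where
      lower : sumFrom 0 (2 +ℕ m) (diagonalTerm m) ≈ fibonacciPolynomial m
      lower = sum-drop-last 0 (suc m) (diagonalTerm m) (diagonalTerm-beyond m (suc m) (ℕₚ.n<1+n m))
      upper : sumFrom 0 (2 +ℕ m) (λ r → diagonalTerm (suc m) (suc r)) ≈ sumFrom 1 (suc m) (diagonalTerm (suc m))
      upper = begin
        sumFrom 0 (2 +ℕ m) (λ r → diagonalTerm (suc m) (suc r)) ≈⟨ sum-shift 0 (2 +ℕ m) (diagonalTerm (suc m)) ⟨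
        sumFrom 1 (2 +ℕ m) (diagonalTerm (suc m))              ≈⟨ sum-drop-last 1 (suc m) (diagonalTerm (suc m))
                                                                     (diagonalTerm-beyond (suc m) (2 +ℕ m) (ℕₚ.n<1+n (suc m))) ⟩
        sumFrom 1 (suc m) (diagonalTerm (suc m))                ∎
      regroup : ∀ a b d u s → a * d + (b * u + a * s) ≈ a * (d + s) + b * u
      regroup = solve 5 (λ a b d u s → ((a :* d) :+ ((b :* u) :+ (a :* s))) := ((a :* (d :+ s)) :+ (b :* u))) refl

    fibonacciPolynomial-0 : fibonacciPolynomial 0 ≈ 1#
    fibonacciPolynomial-0 = begin
      ((1 · 1#) * 1#) * 1# + 0# ≈⟨ +-identityʳ _ ⟩
      ((1 · 1#) * 1#) * 1#      ≈⟨ *-identityʳ _ ⟩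
      (1 · 1#) * 1#             ≈⟨ *-identityʳ _ ⟩
      1# + 0#                   ≈⟨ +-identityʳ 1# ⟩
      1#                        ∎

    fibonacciPolynomial-1 : fibonacciPolynomial 1 ≈ a
    fibonacciPolynomial-1 = begin
      diagonalTerm 1 0 + (diagonalTerm 1 1 + 0#) ≈⟨ +-congˡ (trans (+-identityʳ _) (diagonalTerm-vanish 1 1 ≡.refl)) ⟩
      diagonalTerm 1 0 + 0#                      ≈⟨ +-identityʳ _ ⟩
      diagonalTerm 1 0                           ≈⟨ diagonalTerm-head 0 ⟩
      a * diagonalTerm 0 0                       ≈⟨ *-congˡ (trans (sym (+-identityʳ _)) fibonacciPolynomial-0) ⟩
      a * 1#                                     ≈⟨ *-identityʳ a ⟩
      a                                          ∎

    fibonacciSequence : ℕ → Carrier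
    fibonacciSequence zero    = 0#
    fibonacciSequence (suc m) = fibonacciPolynomial m

    fibonacciSequence-recurrent : Recurrent a b fibonacciSequence
    fibonacciSequence-recurrent zero    = begin
      fibonacciPolynomial 1             ≈⟨ fibonacciPolynomial-1 ⟩
      a                                 ≈⟨ *-identityʳ a ⟨
      a * 1#                            ≈⟨ *-congˡ fibonacciPolynomial-0 ⟨
      a * fibonacciPolynomial 0         ≈⟨ +-identityʳ _ ⟨
      a * fibonacciPolynomial 0 + 0#    ≈⟨ +-congˡ (zeroʳ b) ⟨
      a * fibonacciPolynomial 0 + b * 0# ∎
    fibonacciSequence-recurrent (suc m) = fibonacciPolynomial-step m

  module BinomialTransform (w : Carrier) where

    binomialTerm : (ℕ → Carrier) → ℕ → ℕ → Carrier
    binomialTerm s n j = ((n C j) · 1#) * ((w ^^ (n ∸ j)) * s j)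

    transform : (ℕ → Carrier) → ℕ → Carrier
    transform s n = Σ[ 0 to n ] (binomialTerm s n)

    transform-cong : ∀ {s t} → (∀ j → s j ≈ t j) → ∀ n → transform s n ≈ transform t n
    transform-cong s≈t n = sum-cong 0 (suc n) (λ j _ → *-congˡ (*-congˡ (s≈t j)))

    transform-linear : ∀ x y s t n →
      transform (λ j → x * s j + y * t j) n ≈ x * transform s n + y * transform t n
    transform-linear x y s t n = begin
      sumFrom 0 (suc n) (λ j → ((n C j) · 1#) * ((w ^^ (n ∸ j)) * (x * s j + y * t j)))
        ≈⟨ sum-cong 0 (suc n) (λ j _ → distribute x y _ _ _ _) ⟩
      sumFrom 0 (suc n) (λ j → x * binomialTerm s n j + y * binomialTerm t n j)
        ≈⟨ sum-+ 0 (suc n) _ _ ⟩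
      sumFrom 0 (suc n) (λ j → x * binomialTerm s n j) + sumFrom 0 (suc n) (λ j → y * binomialTerm t n j)
        ≈⟨ +-cong (sum-* 0 (suc n) x _) (sum-* 0 (suc n) y _) ⟩
      x * transform s n + y * transform t n ∎
      where
      distribute : ∀ x y k W S T → k * (W * (x * S + y * T)) ≈ x * (k * (W * S)) + y * (k * (W * T))
      distribute = solve 6 (λ x y k W S T →
        (k :* (W :* ((x :* S) :+ (y :* T)))) := ((x :* (k :* (W :* S))) :+ (y :* (k :* (W :* T))))) refl

    transform-0 : ∀ s → transform s 0 ≈ s 0
    transform-0 s = begin
      (1 · 1#) * (1# * s 0) + 0# ≈⟨ +-identityʳ _ ⟩
      (1 · 1#) * (1# * s 0)      ≈⟨ *-cong (+-identityʳ 1#) (*-identityˡ (s 0)) ⟩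
      1# * s 0                   ≈⟨ *-identityˡ (s 0) ⟩
      s 0                        ∎

    binomialTerm-pascal : ∀ s n j →
      binomialTerm s (suc n) (suc j) ≈ binomialTerm (λ i → s (suc i)) n j + w * binomialTerm s n (suc j)
    binomialTerm-pascal s n j = begin
      ((suc n C suc j) · 1#) * (W * S)
        ≡⟨ ≡.cong (λ k → (k · 1#) * (W * S)) (nCk+nC[k+1]≡[n+1]C[k+1] n j) ⟨
      (((n C j) +ℕ (n C suc j)) · 1#) * (W * S)
        ≈⟨ *-congʳ (×-homo-+ 1# (n C j) (n C suc j)) ⟩
      (X + Y) * (W * S)
        ≈⟨ distribʳ (W * S) X Y ⟩
      X * (W * S) + Y * (W * S)
        ≈⟨ +-congˡ (*-assoc Y W S) ⟨
      X * (W * S) + (Y * W) * S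
        ≈⟨ +-congˡ (*-congʳ (power-step (n C suc j) w n j (λ n≤j → k>n⇒nCk≡0 (s≤s n≤j)))) ⟩
      X * (W * S) + (w * (Y * W′)) * S
        ≈⟨ +-congˡ (reassociate w Y W′ S) ⟩
      X * (W * S) + w * (Y * (W′ * S)) ∎
      where
      X = (n C j) · 1#
      Y = (n C suc j) · 1#
      W = w ^^ (n ∸ j)
      W′ = w ^^ (n ∸ suc j)
      S = s (suc j)
      reassociate : ∀ w Y W S → (w * (Y * W)) * S ≈ w * (Y * (W * S))
      reassociate = solve 4 (λ w Y W S → ((w :* (Y :* W)) :* S) := (w :* (Y :* (W :* S)))) refl

    transform-step : ∀ s n → transform s (suc n) ≈ w * transform s n + transform (λ i → s (suc i)) n
    transform-step s n = begin
      binomialTerm s (suc n) 0 + sumFrom 1 (suc n) (binomialTerm s (suc n))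
        ≈⟨ +-cong (reassociate w _ _ _) (sum-shift 0 (suc n) (binomialTerm s (suc n))) ⟩
      w * binomialTerm s n 0 + sumFrom 0 (suc n) (λ j → binomialTerm s (suc n) (suc j))
        ≈⟨ +-congˡ (sum-cong 0 (suc n) (λ j _ → binomialTerm-pascal s n j)) ⟩
      w * binomialTerm s n 0 + sumFrom 0 (suc n) (λ j → binomialTerm s′ n j + w * binomialTerm s n (suc j))
        ≈⟨ +-congˡ (sum-+ 0 (suc n) _ _) ⟩
      w * binomialTerm s n 0 + (transform s′ n + sumFrom 0 (suc n) (λ j → w * binomialTerm s n (suc j)))
        ≈⟨ +-congˡ (+-congˡ (trans (sum-* 0 (suc n) w _) (*-congˡ upper))) ⟩
      w * binomialTerm s n 0 + (transform s′ n + w * sumFrom 1 n (binomialTerm s n))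
        ≈⟨ regroup w _ _ _ ⟩
      w * transform s n + transform s′ n ∎
      where
      s′ : ℕ → Carrier
      s′ i = s (suc i)
      upper : sumFrom 0 (suc n) (λ j → binomialTerm s n (suc j)) ≈ sumFrom 1 n (binomialTerm s n)
      upper = begin
        sumFrom 0 (suc n) (λ j → binomialTerm s n (suc j)) ≈⟨ sum-shift 0 (suc n) (binomialTerm s n) ⟨
        sumFrom 1 (suc n) (binomialTerm s n)               ≈⟨ sum-drop-last 1 n (binomialTerm s n) top≈0 ⟩
        sumFrom 1 n (binomialTerm s n)                     ∎
        where
        top≈0 : binomialTerm s n (suc n) ≈ 0#
        top≈0 = begin
          ((n C suc n) · 1#) * P ≡⟨ ≡.cong (λ k → (k · 1#) * P) (k>n⇒nCk≡0 (ℕₚ.n<1+n n)) ⟩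
          0# * P                 ≈⟨ zeroˡ P ⟩
          0#                     ∎
          where
          P = (w ^^ (n ∸ suc n)) * s (suc n)
      reassociate : ∀ w k W S → k * ((w * W) * S) ≈ w * (k * (W * S))
      reassociate = solve 4 (λ w k W S → (k :* ((w :* W) :* S)) := (w :* (k :* (W :* S)))) refl
      regroup : ∀ w h t u → w * h + (t + w * u) ≈ w * (h + u) + t
      regroup = solve 4 (λ w h t u → ((w :* h) :+ (t :+ (w :* u))) := ((w :* (h :+ u)) :+ t)) refl

    -- The transform turns the (a, b)-recurrence into the Fibonacci recurrence
    -- when a + 2w = 1 and b + w² = 1 + w: with T = T s n and T′ = T (s ∘ suc) n,
    -- T s (n+2) = (w² + b) T + (2w + a) T′ and T s (n+1) + T s n = (1 + w) T + T′.
    transform-recurrent : ∀ {a b s} → a + (w + w) ≈ 1# → b + w * w ≈ 1# + w →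
                          Recurrent a b s → FibonacciRecurrent (transform s)
    transform-recurrent {a} {b} {s} a+2w≈1 b+w²≈1+w rec n = begin
      transform s (suc (suc n))
        ≈⟨ transform-step s (suc n) ⟩
      w * transform s (suc n) + transform s′ (suc n)
        ≈⟨ +-cong (*-congˡ (transform-step s n)) (transform-step s′ n) ⟩
      w * (w * T + T′) + (w * T′ + transform s″ n)
        ≈⟨ +-congˡ (+-congˡ (trans (transform-cong rec n) (transform-linear a b s′ s n))) ⟩
      w * (w * T + T′) + (w * T′ + (a * T′ + b * T))
        ≈⟨ collect w a b T T′ ⟩
      (b + w * w) * T + (a + (w + w)) * T′
        ≈⟨ +-cong (*-congʳ b+w²≈1+w) (*-congʳ a+2w≈1) ⟩
      (1# + w) * T + 1# * T′
        ≈⟨ +-cong (trans (distribʳ T 1# w) (+-congʳ (*-identityˡ T))) (*-identityˡ T′) ⟩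
      (T + w * T) + T′
        ≈⟨ regroup T (w * T) T′ ⟩
      (w * T + T′) + T
        ≈⟨ +-congʳ (transform-step s n) ⟨
      transform s (suc n) + transform s n ∎
      where
      s′ s″ : ℕ → Carrier
      s′ i = s (suc i)
      s″ i = s (suc (suc i))
      T = transform s n
      T′ = transform s′ n
      collect : ∀ w a b T T′ →
        w * (w * T + T′) + (w * T′ + (a * T′ + b * T)) ≈ (b + w * w) * T + (a + (w + w)) * T′
      collect = solve 5 (λ w a b T T′ →
        ((w :* ((w :* T) :+ T′)) :+ ((w :* T′) :+ ((a :* T′) :+ (b :* T))))
          := (((b :+ (w :* w)) :* T) :+ ((a :+ (w :+ w)) :* T′))) refl
      regroup : ∀ x y z → (x + y) + z ≈ (y + z) + x
      regroup = solve 3 (λ x y z → ((x :+ y) :+ z) := ((y :+ z) :+ x)) refl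

  -- The identity holds for every w: the transform of 0, U 0, U 1, … with
  -- a = 1 - 2w, b = 1 + w - w² is Fibonacci-recurrent and starts 0, 1; its
  -- j = 0 term vanishes and its j-th term is the j-th outer summand.
  fibonacci-binomial : (w : Carrier) (n : ℕ) →
    (fib n · 1#) ≈
      Σ[ 1 to n ] (λ j → Σ[ 0 to ((j ∸ 1) / 2) ] (λ r →
        ((n C j) · 1#) * ((((j ∸ 1) ∸ r) C r) · 1#) * (w ^^ (n ∸ j))
          * ((1# - (w + w)) ^^ ((j ∸ 1) ∸ (2 *ℕ r)))
          * ((1# + w - (w * w)) ^^ r)))
  fibonacci-binomial w n = begin
    fib n · 1#                          ≈⟨ fib-unique (transform V) V-fibonacci V-start₀ V-start₁ n ⟩
    transform V n                       ≈⟨ +-congʳ (trans (*-congˡ (zeroʳ _)) (zeroʳ _)) ⟩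
    0# + sumFrom 1 n (binomialTerm V n) ≈⟨ +-identityˡ _ ⟩
    sumFrom 1 n (binomialTerm V n)      ≈⟨ sum-cong 1 n (λ { (suc m) _ → expand m }) ⟩
    _                                   ∎
    where
    open FibonacciPolynomials (1# - (w + w)) (1# + w - (w * w))
    open BinomialTransform w
    V : ℕ → Carrier
    V = fibonacciSequence
    V-fibonacci : FibonacciRecurrent (transform V)
    V-fibonacci = transform-recurrent (minus-plus 1# (w + w)) (minus-plus (1# + w) (w * w))
                                      fibonacciSequence-recurrent
    V-start₀ : transform V 0 ≈ 0#
    V-start₀ = transform-0 V
    V-start₁ : transform V 1 ≈ 1#
    V-start₁ = begin
      transform V 1
        ≈⟨ transform-step V 0 ⟩
      w * transform V 0 + transform fibonacciPolynomial 0
        ≈⟨ +-cong (trans (*-congˡ V-start₀) (zeroʳ w)) (transform-0 fibonacciPolynomial) ⟩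
      0# + fibonacciPolynomial 0
        ≈⟨ +-identityˡ _ ⟩
      fibonacciPolynomial 0
        ≈⟨ fibonacciPolynomial-0 ⟩
      1# ∎
    expand : ∀ m → binomialTerm V n (suc m) ≈ Σ[ 0 to m / 2 ] (λ r →
        ((n C suc m) · 1#) * ((((m ∸ r) C r) · 1#)) * (w ^^ (n ∸ suc m))
          * ((1# - (w + w)) ^^ (m ∸ (2 *ℕ r)))
          * ((1# + w - (w * w)) ^^ r))
    expand m = begin
      K * (W * fibonacciPolynomial m)
        ≈⟨ *-congˡ (*-congˡ (fibonacciPolynomial-truncate m)) ⟩
      K * (W * Σ[ 0 to m / 2 ] (diagonalTerm m))
        ≈⟨ *-assoc K W _ ⟨
      (K * W) * Σ[ 0 to m / 2 ] (diagonalTerm m)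
        ≈⟨ sum-* 0 (suc (m / 2)) (K * W) (diagonalTerm m) ⟨
      Σ[ 0 to m / 2 ] (λ r → (K * W) * diagonalTerm m r)
        ≈⟨ sum-cong 0 (suc (m / 2)) (λ r _ → reorder K W _ _ _) ⟩
      _ ∎
      where
      K = (n C suc m) · 1#
      W = w ^^ (n ∸ suc m)
      reorder : ∀ K W c A B → (K * W) * ((c * A) * B) ≈ K * c * W * A * B
      reorder = solve 5 (λ K W c A B → ((K :* W) :* ((c :* A) :* B)) := ((((K :* c) :* W) :* A) :* B)) refl

corollary2 : ∀ {c ℓ} (R : CommutativeRing c ℓ) →
    let open CommutativeRing R
        open RingSum R
        _·_ = _×_ (Semiring.rawSemiring semiring)
        _^^_ = _^_ (Semiring.rawSemiring semiring)
    in (w : Carrier) →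
       ¬ (w ≈ 0#) →
       ¬ ((w + w) ≈ 1#) →
       ¬ (((w * w) - w - 1#) ≈ 0#) →
       (n : ℕ) → NonZero n →
       (fib n · 1#) ≈
         Σ[ 1 to n ] (λ j → Σ[ 0 to ((j ∸ 1) / 2) ] (λ r →
           ((n C j) · 1#) * ((((j ∸ 1) ∸ r) C r) · 1#) * (w ^^ (n ∸ j))
             * ((1# - (w + w)) ^^ ((j ∸ 1) ∸ (2 *ℕ r)))
             * ((1# + w - (w * w)) ^^ r)))
corollary2 R w _ _ _ n _ = FibonacciIdentity.fibonacci-binomial R w n
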